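{- Let $n,m$ be positive integers and $\mathbf a,\mathbf b\in\mathbb N^n$. Then the $m$th Pitman–Stanley polytope $\mathrm{PS}_n^m(\mathbf a,\mathbf b)$ is integrally equivalent to the flow polytope $\mathcal F_{G(n,m)}(\mathbf a,\mathbf b)$.
   Context: $\mathrm{PS}_n^m(\mathbf a,\mathbf b)$ is the set of real matrices $(x_{ij})_{1\le i\le n,\,1\le j\le m}$ with nonnegative entries such that for every $i=1,\dots,n$: $b_1+\dots+b_i\le x_{1m}+\dots+x_{im}\le x_{1,m-1}+\dots+x_{i,m-1}\le\cdots\le x_{11}+\dots+x_{i1}\le a_1+\dots+a_i$. $G(n,m)$ is the directed graph with vertex set $\{(i,j):1\le i\le n,\ 0\le j\le m\}\cup\{s\}$ and edges: $((i,j),(i,j+1))$ for $1\le i\le n$, $0\le j\le m-1$; $((i,j),(i+1,j))$ for $1\le i\le n-1$, $0\le j\le m$; and $((n,j),s)$ for $0\le j\le m$. The flow polytope $\mathcal F_{G(n,m)}(\mathbf a,\mathbf b)$ is the set of assignments $f:E(G(n,m))\to\mathbb R_{\ge0}$ such that at every vertex, (sum of $f$ over outgoing edges) $-$ (sum of $f$ over incoming edges) equals the prescribed netflow: $a_i$ at $(i,0)$, $-b_i$ at $(i,m)$, $-\sum_i a_i+\sum_i b_i$ at $s$, and $0$ at all other vertices. Two lattice polytopes $P\subset\mathbb R^p$, $Q\subset\mathbb R^q$ are integrally equivalent if there is an affine map $\Phi:\mathbb R^p\to\mathbb R^q$ whose restriction to $P$ is a bijection $P\to Q$ that preserves the lat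tice.
   Formalization: The polytopes $\mathrm{PS}_n^m(\mathbf a,\mathbf b)$ and $\mathcal F_{G(n,m)}(\mathbf a,\mathbf b)$ consist only of their rational points, and the affine map Φ and the affine hulls are taken over ℚ rather than ℝ. -}

module Defs where

open import Data.Nat as ℕ using (ℕ; zero; suc; _∸_; _≟_)
open import Data.Integer as ℤ using (ℤ; +_)
open import Data.Rational using (ℚ; 0ℚ; 1ℚ; _+_; _*_; _-_; -_; _≤_; _/_)
open import Data.Fin using (Fin; zero; suc; toℕ; inject₁; combine; _↑ˡ_; _↑ʳ_)
open import Data.Product using (Σ; _×_; _,_)
open import Relation.Binary.PropositionalEquality using (_≡_)
open import Relation.Nullary using (yes; no)
open import Level using (0ℓ)
open import Relation.Unary using (Pred)

ℕ→ℚ : ℕ → ℚ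
ℕ→ℚ k = (+ k) / 1

IsInt : ℚ → Set
IsInt q = Σ ℤ λ z → q ≡ z / 1

sumFin : (d : ℕ) → (Fin d → ℚ) → ℚ
sumFin zero    f = 0ℚ
sumFin (suc d) f = f zero + sumFin d (λ k → f (suc k))

prefix : ∀ {n} → (Fin n → ℚ) → Fin n → ℚ
prefix f zero    = f zero
prefix f (suc i) = f zero + prefix (λ k → f (suc k)) i

ℚ^ : ℕ → Set
ℚ^ d = Fin d → ℚ

Region : ℕ → Set₁
Region d = Pred (ℚ^ d) 0ℓ

record Affine (p q : ℕ) : Set where
  field
    mat   : Fin q → Fin p → ℚ
    shift : Fin q → ℚ

applyAff : ∀ {p q} → Affine p q → ℚ^ p → ℚ^ q
applyAff Φ x k = Affine.shift Φ k + sumFin _ (λ l → Affine.mat Φ k l * x l)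

_≐_ : ∀ {d} → ℚ^ d → ℚ^ d → Set
x ≐ y = ∀ k → x k ≡ y k

InAff : ∀ {d} → Region d → ℚ^ d → Set
InAff {d} P x =
  Σ ℕ λ r → Σ (Fin r → ℚ) λ w → Σ (Fin r → ℚ^ d) λ pts →
    (∀ t → P (pts t)) × (sumFin r w ≡ 1ℚ) ×
    (∀ l → x l ≡ sumFin r (λ t → w t * pts t l))

IsIntPt : ∀ {d} → ℚ^ d → Set
IsIntPt x = ∀ k → IsInt (x k)

BijOn : ∀ {p q} → Affine p q → (ℚ^ p → Set) → (ℚ^ q → Set) → Set
BijOn Φ S T =
  (∀ x → S x → T (applyAff Φ x)) ×
  (∀ x y → S x → S y → applyAff Φ x ≐ applyAff Φ y → x ≐ y) ×
  (∀ y → T y → Σ _ λ x → S x × (applyAff Φ x ≐ y))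

IntegrallyEquivalent : ∀ {p q} → Region p → Region q → Set
IntegrallyEquivalent {p} {q} P Q =
  Σ (Affine p q) λ Φ →
    BijOn Φ P Q ×
    BijOn Φ (λ x → InAff P x × IsIntPt x) (λ y → InAff Q y × IsIntPt y)

-- Pitman–Stanley polytope PS_n^m(a,b) ⊆ ℚ^{n·m};
-- entry x_{ij} (0-based i : Fin n, j : Fin m) is coordinate  combine i j.

entry : ∀ {n m} → ℚ^ (n ℕ.* m) → Fin n → Fin m → ℚ
entry {n} {m} x i j = x (combine i j)

PS : (n m : ℕ) → (a b : Fin n → ℕ) → Region (n ℕ.* m)
PS n m a b x =
  (∀ i j → 0ℚ ≤ entry {n} {m} x i j) ×
  (∀ i →
    (∀ (j : Fin m) → suc (toℕ j) ≡ m →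
       prefix (λ k → ℕ→ℚ (b k)) i ≤ prefix (λ k → entry {n} {m} x k j) i) ×
    (∀ (j j' : Fin m) → toℕ j' ≡ suc (toℕ j) →
       prefix (λ k → entry {n} {m} x k j') i ≤ prefix (λ k → entry {n} {m} x k j) i) ×
    (∀ (j : Fin m) → toℕ j ≡ 0 →
       prefix (λ k → entry {n} {m} x k j) i ≤ prefix (λ k → ℕ→ℚ (a k)) i))

-- Vertices (i,j), i : Fin n, j : Fin (suc m)
-- (0-based rows), plus the sink s.  Edges:
--   horizontal  (i,j) → (i,j+1)   for i : Fin n, j : Fin m
--   down        (i,j) → (i+1,j)   for i < n-1, and (n-1,j) → s,
--               indexed by i : Fin n, j : Fin (suc m).

FlowDim : ℕ → ℕ → ℕ
FlowDim n m = n ℕ.* m ℕ.+ n ℕ.* suc m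

horiz : ∀ {n m} → ℚ^ (FlowDim n m) → Fin n → Fin m → ℚ
horiz {n} {m} f i j = f (combine i j ↑ˡ (n ℕ.* suc m))

down : ∀ {n m} → ℚ^ (FlowDim n m) → Fin n → Fin (suc m) → ℚ
down {n} {m} f i j = f ((n ℕ.* m) ↑ʳ combine i j)

-- flow on the outgoing horizontal edge at column j (0 if j is last)
hOut : ∀ {m} → (Fin m → ℚ) → Fin (suc m) → ℚ
hOut {zero}  h zero    = 0ℚ
hOut {suc m} h zero    = h zero
hOut {suc m} h (suc j) = hOut (λ k → h (suc k)) j

-- flow on the incoming horizontal edge at column j (0 if j = 0)
hIn : ∀ {m} → (Fin m → ℚ) → Fin (suc m) → ℚ
hIn h zero    = 0ℚ
hIn h (suc j) = h j

-- flow on the incoming down edge at row i (0 if i = 0)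
dIn : ∀ {n} → (Fin n → ℚ) → Fin n → ℚ
dIn {suc k} d zero    = 0ℚ
dIn {suc k} d (suc i) = d (inject₁ i)

demand : ∀ {m} → ℚ → ℚ → Fin (suc m) → ℚ
demand α β zero = α
demand {m} α β (suc j) with toℕ (suc j) ≟ m
... | yes _ = - β
... | no  _ = 0ℚ

Flow : (n m : ℕ) → (a b : Fin n → ℕ) → Region (FlowDim n m)
Flow n m a b f =
  (∀ k → 0ℚ ≤ f k) ×
  (∀ (i : Fin n) (j : Fin (suc m)) →
     (hOut (horiz f i) j + down f i j)
       - (hIn (horiz f i) j + dIn (λ r → down f r j) i)
     ≡ demand (ℕ→ℚ (a i)) (ℕ→ℚ (b i)) j) ×
  -- at the sink s: out − in = −Σ a_i + Σ b_i (s has no outgoing edges;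
  -- its incoming edges are the down edges of the last row)
  (∀ (l : Fin n) → suc (toℕ l) ≡ n →
     0ℚ - sumFin (suc m) (λ j → down f l j)
     ≡ (- sumFin n (λ i → ℕ→ℚ (a i))) + sumFin n (λ i → ℕ→ℚ (b i)))

-- Keep the matrix x as the horizontal flow (x_{ij} on the edge (i,j-1) → (i,j)) and send down
-- the vertical edge leaving (i,j) the amount D_{ij} = X_{ij} − X_{i,j+1}, where X_{ij} is the
-- column prefix sum x_{1j} + ⋯ + x_{ij}, with the conventions X_{i0} = a_1 + ⋯ + a_i and
-- X_{i,m+1} = b_1 + ⋯ + b_i. Nonnegativity of D is exactly the chain of inequalities defining
-- PS, and conservation at (i,j) holds because D telescopes in i. Conversely conservation
-- determines the vertical flow row by row from the horizontal one, so the inverse map just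
-- forgets the vertical edges. Both maps are affine and send lattice points to lattice points.

module Submission where

open import Algebra.Bundles using (CommutativeMonoid)
import Algebra.Properties.CommutativeSemigroup as CommSemigroupProperties
open import Data.Empty using (⊥-elim)
open import Data.Fin using (Fin; zero; suc; toℕ; fromℕ; inject₁; combine; remQuot; splitAt; join; _↑ˡ_; _↑ʳ_)
open import Data.Fin.Properties using (toℕ-fromℕ; toℕ-inject₁; toℕ-injective; toℕ<n; splitAt-↑ˡ; splitAt-↑ʳ; join-splitAt; remQuot-combine; combine-remQuot)
open import Data.Integer as ℤ using (-[1+_])
open import Data.Nat as ℕ using (ℕ; zero; suc; _≤_)
open import Data.Nat.Coprimality using (1-coprimeTo) renaming (sym to coprime-sym)
open import Data.Nat.Properties using (suc-injective; <-irrefl)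
open import Data.Product using (Σ; _×_; _,_; proj₁; proj₂)
open import Data.Rational using (ℚ; mkℚ; 0ℚ; 1ℚ; _+_; _*_; _-_; -_; _/_) renaming (_≤_ to _≤ℚ_)
import Data.Rational.Properties as ℚ
open import Data.Rational.Solver using (module +-*-Solver)
open import Data.Sum using (_⊎_; inj₁; inj₂)
open import Function using (_∘_)
open import Relation.Binary.PropositionalEquality
open import Relation.Nullary using (¬_; yes; no)

open import Defs

open +-*-Solver
open CommSemigroupProperties (CommutativeMonoid.commutativeSemigroup ℚ.+-0-commutativeMonoid)
  using () renaming (interchange to +-interchange)
open CommSemigroupProperties (CommutativeMonoid.commutativeSemigroup ℚ.*-1-commutativeMonoid)
  using () renaming (x∙yz≈y∙xz to *-leftSwap)

0≤p-q⇒q≤p : ∀ {p q} → 0ℚ ≤ℚ p - q → q ≤ℚ p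
0≤p-q⇒q≤p {p} {q} 0≤p-q = subst₂ _≤ℚ_ (ℚ.+-identityˡ q)
  (solve 2 (λ p q → (p :- q) :+ q := p) refl p q) (ℚ.+-mono-≤ 0≤p-q (ℚ.≤-refl {q}))

q≤p⇒0≤p-q : ∀ {p q} → q ≤ℚ p → 0ℚ ≤ℚ p - q
q≤p⇒0≤p-q {p} {q} q≤p = subst (_≤ℚ p - q) (ℚ.+-inverseʳ q) (ℚ.+-mono-≤ q≤p (ℚ.≤-refl { - q}))

sumFin-cong : ∀ d {f g : ℚ^ d} → f ≐ g → sumFin d f ≡ sumFin d g
sumFin-cong zero    f≐g = refl
sumFin-cong (suc d) f≐g = cong₂ _+_ (f≐g zero) (sumFin-cong d (f≐g ∘ suc))

sumFin-zero : ∀ d → sumFin d (λ _ → 0ℚ) ≡ 0ℚ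
sumFin-zero zero    = refl
sumFin-zero (suc d) = cong (0ℚ +_) (sumFin-zero d)

sumFin-+ : ∀ d (f g : ℚ^ d) → sumFin d (λ k → f k + g k) ≡ sumFin d f + sumFin d g
sumFin-+ zero    f g = refl
sumFin-+ (suc d) f g =
  trans (cong (f zero + g zero +_) (sumFin-+ d (f ∘ suc) (g ∘ suc)))
        (+-interchange (f zero) (g zero) (sumFin d (f ∘ suc)) (sumFin d (g ∘ suc)))

sumFin-sub : ∀ d (f g : ℚ^ d) → sumFin d (λ k → f k - g k) ≡ sumFin d f - sumFin d g
sumFin-sub zero    f g = refl
sumFin-sub (suc d) f g =
  trans (cong (f zero - g zero +_) (sumFin-sub d (f ∘ suc) (g ∘ suc)))
        (solve 4 (λ p q r s → (p :- q) :+ (r :- s) := (p :+ r) :- (q :+ s)) refl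
          (f zero) (g zero) (sumFin d (f ∘ suc)) (sumFin d (g ∘ suc)))

*-distribˡ-sumFin : ∀ d c (f : ℚ^ d) → c * sumFin d f ≡ sumFin d (λ k → c * f k)
*-distribˡ-sumFin zero    c f = ℚ.*-zeroʳ c
*-distribˡ-sumFin (suc d) c f =
  trans (ℚ.*-distribˡ-+ c (f zero) _) (cong (c * f zero +_) (*-distribˡ-sumFin d c (f ∘ suc)))

sumFin-comm : ∀ d r (g : Fin d → Fin r → ℚ) →
  sumFin d (λ l → sumFin r (g l)) ≡ sumFin r (λ t → sumFin d (λ l → g l t))
sumFin-comm zero    r g = sym (sumFin-zero r)
sumFin-comm (suc d) r g =
  trans (cong (sumFin r (g zero) +_) (sumFin-comm d r (g ∘ suc)))
        (sym (sumFin-+ r (g zero) (λ t → sumFin d (λ l → g (suc l) t))))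

prefix-suc : ∀ {n} (f : Fin (suc n) → ℚ) (i : Fin n) → prefix f (suc i) ≡ prefix f (inject₁ i) + f (suc i)
prefix-suc f zero    = refl
prefix-suc f (suc i) = trans (cong (f zero +_) (prefix-suc (f ∘ suc) i)) (sym (ℚ.+-assoc (f zero) _ _))

prefix-last : ∀ {n} (f : Fin n → ℚ) (l : Fin n) → suc (toℕ l) ≡ n → prefix f l ≡ sumFin n f
prefix-last         f zero    refl = sym (ℚ.+-identityʳ (f zero))
prefix-last {suc n} f (suc l) eq = cong (f zero +_) (prefix-last (f ∘ suc) l (suc-injective eq))

applyAff-affineCombination : ∀ {p q r} (Φ : Affine p q) (w : Fin r → ℚ) (pts : Fin r → ℚ^ p) (x : ℚ^ p) →
  sumFin r w ≡ 1ℚ → (∀ l → x l ≡ sumFin r (λ t → w t * pts t l)) →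
  ∀ k → applyAff Φ x k ≡ sumFin r (λ t → w t * applyAff Φ (pts t) k)
applyAff-affineCombination {p} {r = r} Φ w pts x Σw≡1 x≡Σ k = begin
  s + sumFin p (λ l → M l * x l)
    ≡⟨ cong (s +_) (sumFin-cong p λ l → trans (cong (M l *_) (x≡Σ l)) (*-distribˡ-sumFin r (M l) _)) ⟩
  s + sumFin p (λ l → sumFin r (λ t → M l * (w t * pts t l)))
    ≡⟨ cong (s +_) (sumFin-cong p λ l → sumFin-cong r λ t → *-leftSwap (M l) (w t) (pts t l)) ⟩
  s + sumFin p (λ l → sumFin r (λ t → w t * (M l * pts t l)))
    ≡⟨ cong (s +_) (sumFin-comm p r _) ⟩
  s + sumFin r (λ t → sumFin p (λ l → w t * (M l * pts t l)))
    ≡⟨ cong (s +_) (sumFin-cong r λ t → sym (*-distribˡ-sumFin p (w t) _)) ⟩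
  s + sumFin r (λ t → w t * Mpts t)
    ≡⟨ cong (_+ sumFin r (λ t → w t * Mpts t)) s≡Σsw ⟩
  sumFin r (λ t → s * w t) + sumFin r (λ t → w t * Mpts t)
    ≡⟨ sym (sumFin-+ r _ _) ⟩
  sumFin r (λ t → s * w t + w t * Mpts t)
    ≡⟨ sumFin-cong r (λ t → solve 3 (λ a b c → a :* b :+ b :* c := b :* (a :+ c)) refl s (w t) (Mpts t)) ⟩
  sumFin r (λ t → w t * applyAff Φ (pts t) k) ∎
  where
  open ≡-Reasoning
  s = Affine.shift Φ k
  M = Affine.mat Φ k
  Mpts : Fin r → ℚ
  Mpts t = sumFin p (λ l → M l * pts t l)
  s≡Σsw : s ≡ sumFin r (λ t → s * w t)
  s≡Σsw = trans (sym (ℚ.*-identityʳ s)) (trans (cong (s *_) (sym Σw≡1)) (*-distribˡ-sumFin r s w))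

-- On the affine hulls the projection is still inverted by Φ because Φ preserves affine combinations.
integrallyEquivalent-byProjection :
  ∀ {p q} {P : Region p} {Q : Region q} (Φ : Affine p q) (ι : Fin p → Fin q) →
  (∀ x l → applyAff Φ x (ι l) ≡ x l) →
  (∀ x → P x → Q (applyAff Φ x)) →
  (∀ y → Q y → P (λ l → y (ι l))) →
  (∀ y → Q y → applyAff Φ (λ l → y (ι l)) ≐ y) →
  (∀ x → IsIntPt x → IsIntPt (applyAff Φ x)) →
  IntegrallyEquivalent P Q
integrallyEquivalent-byProjection {p} {q} {P} {Q} Φ ι Φι≡ P⇒Q Q⇒P Φπ≐ Φ-integral =
  Φ , (P⇒Q , (λ x x′ _ _ → injective x x′) , λ y Qy → π y , Q⇒P y Qy , Φπ≐ y Qy)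
    , (hull⇒ , (λ x x′ _ _ → injective x x′) , hull⇐)
  where
  π : ℚ^ q → ℚ^ p
  π y l = y (ι l)

  injective : ∀ x x′ → applyAff Φ x ≐ applyAff Φ x′ → x ≐ x′
  injective x x′ eq l = trans (sym (Φι≡ x l)) (trans (eq (ι l)) (Φι≡ x′ l))

  hull⇒ : ∀ x → InAff P x × IsIntPt x → InAff Q (applyAff Φ x) × IsIntPt (applyAff Φ x)
  hull⇒ x ((r , w , pts , Ppts , Σw≡1 , x≡Σ) , x-int) =
    (r , w , (applyAff Φ ∘ pts) , (λ t → P⇒Q (pts t) (Ppts t)) , Σw≡1 ,
      applyAff-affineCombination Φ w pts x Σw≡1 x≡Σ) , Φ-integral x x-int

  hull⇐ : ∀ y → InAff Q y × IsIntPt y → Σ (ℚ^ p) λ x → (InAff P x × IsIntPt x) × (applyAff Φ x ≐ y)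
  hull⇐ y ((r , w , pts , Qpts , Σw≡1 , y≡Σ) , y-int) =
    π y , ((r , w , (π ∘ pts) , (λ t → Q⇒P (pts t) (Qpts t)) , Σw≡1 , y≡Σ ∘ ι) , y-int ∘ ι) ,
    λ k → trans (applyAff-affineCombination Φ w (π ∘ pts) (π y) Σw≡1 (y≡Σ ∘ ι) k)
                (trans (sumFin-cong r λ t → cong (w t *_) (Φπ≐ (pts t) (Qpts t) k)) (sym (y≡Σ k)))

record IsLinear {d : ℕ} (φ : ℚ^ d → ℚ) : Set where
  field
    ≐-cong : ∀ {x y} → x ≐ y → φ x ≡ φ y
    +-homo : ∀ x y → φ (λ k → x k + y k) ≡ φ x + φ y
    *-homo : ∀ c x → φ (λ k → c * x k) ≡ c * φ x

unit : ∀ {d} → Fin d → ℚ^ d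
unit zero    zero    = 1ℚ
unit zero    (suc _) = 0ℚ
unit (suc _) zero    = 0ℚ
unit (suc l) (suc k) = unit l k

linear-expansion : ∀ d {φ : ℚ^ d → ℚ} → IsLinear φ → ∀ x → sumFin d (λ l → φ (unit l) * x l) ≡ φ x
linear-expansion zero {φ} L x =
  sym (trans (≐-cong (λ ())) (trans (*-homo 0ℚ x) (ℚ.*-zeroˡ (φ x))))
  where open IsLinear L
linear-expansion (suc d) {φ} L x = begin
  φ (unit zero) * x zero + sumFin d (λ l → φ (unit (suc l)) * x (suc l))
    ≡⟨ cong₂ _+_ (ℚ.*-comm (φ (unit zero)) (x zero))
                 (sumFin-cong d λ l → cong (_* x (suc l)) (≐-cong (λ { zero → refl ; (suc _) → refl }))) ⟩
  x zero * φ (unit zero) + sumFin d (λ l → φ (cons0 (unit l)) * x (suc l))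
    ≡⟨ cong₂ _+_ (sym (*-homo (x zero) (unit zero))) (linear-expansion d tail-linear (x ∘ suc)) ⟩
  φ (λ k → x zero * unit zero k) + φ (cons0 (x ∘ suc))
    ≡⟨ sym (+-homo _ _) ⟩
  φ (λ k → x zero * unit zero k + cons0 (x ∘ suc) k)
    ≡⟨ ≐-cong (λ { zero → solve 1 (λ a → a :* con 1ℚ :+ con 0ℚ := a) refl (x zero)
                 ; (suc k) → solve 2 (λ a b → a :* con 0ℚ :+ b := b) refl (x zero) (x (suc k)) }) ⟩
  φ x ∎
  where
  open ≡-Reasoning
  open IsLinear L
  cons0 : ℚ^ d → ℚ^ (suc d)
  cons0 y zero    = 0ℚ
  cons0 y (suc k) = y k
  tail-linear : IsLinear (φ ∘ cons0)
  tail-linear = record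
    { ≐-cong = λ y≐z → ≐-cong (λ { zero → refl ; (suc k) → y≐z k })
    ; +-homo = λ y z → trans (≐-cong (λ { zero → sym (ℚ.+-identityʳ 0ℚ) ; (suc k) → refl })) (+-homo (cons0 y) (cons0 z))
    ; *-homo = λ c y → trans (≐-cong (λ { zero → sym (ℚ.*-zeroʳ c) ; (suc k) → refl })) (*-homo c (cons0 y))
    }

affineFromForms : ∀ {p q} → (Fin q → ℚ) → (Fin q → ℚ^ p → ℚ) → Affine p q
affineFromForms s φ = record { mat = λ k l → φ k (unit l) ; shift = s }

applyAff-affineFromForms : ∀ {p q} (s : Fin q → ℚ) (φ : Fin q → ℚ^ p → ℚ) → (∀ k → IsLinear (φ k)) →
  ∀ x k → applyAff (affineFromForms s φ) x k ≡ s k + φ k x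
applyAff-affineFromForms {p} s φ L x k = cong (s k +_) (linear-expansion p (L k) x)

zero-linear : ∀ {d} → IsLinear {d} (λ _ → 0ℚ)
zero-linear = record { ≐-cong = λ _ → refl ; +-homo = λ _ _ → refl ; *-homo = λ c _ → sym (ℚ.*-zeroʳ c) }

eval-linear : ∀ {d} (l : Fin d) → IsLinear {d} (λ x → x l)
eval-linear l = record { ≐-cong = λ x≐y → x≐y l ; +-homo = λ _ _ → refl ; *-homo = λ _ _ → refl }

+-linear : ∀ {d} {φ ψ : ℚ^ d → ℚ} → IsLinear φ → IsLinear ψ → IsLinear (λ x → φ x + ψ x)
+-linear {φ = φ} {ψ} L M = record
  { ≐-cong = λ x≐y → cong₂ _+_ (L.≐-cong x≐y) (M.≐-cong x≐y)
  ; +-homo = λ x y → trans (cong₂ _+_ (L.+-homo x y) (M.+-homo x y)) (+-interchange (φ x) (φ y) (ψ x) (ψ y))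
  ; *-homo = λ c x → trans (cong₂ _+_ (L.*-homo c x) (M.*-homo c x)) (sym (ℚ.*-distribˡ-+ c (φ x) (ψ x)))
  }
  where module L = IsLinear L; module M = IsLinear M

sub-linear : ∀ {d} {φ ψ : ℚ^ d → ℚ} → IsLinear φ → IsLinear ψ → IsLinear (λ x → φ x - ψ x)
sub-linear {φ = φ} {ψ} L M = record
  { ≐-cong = λ x≐y → cong₂ _-_ (L.≐-cong x≐y) (M.≐-cong x≐y)
  ; +-homo = λ x y → trans (cong₂ _-_ (L.+-homo x y) (M.+-homo x y))
      (solve 4 (λ a b c e → (a :+ b) :- (c :+ e) := (a :- c) :+ (b :- e)) refl (φ x) (φ y) (ψ x) (ψ y))
  ; *-homo = λ c x → trans (cong₂ _-_ (L.*-homo c x) (M.*-homo c x))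
      (solve 3 (λ c a b → c :* a :- c :* b := c :* (a :- b)) refl c (φ x) (ψ x))
  }
  where module L = IsLinear L; module M = IsLinear M

prefix-linear : ∀ {d k} (ψ : Fin k → ℚ^ d → ℚ) → (∀ r → IsLinear (ψ r)) →
  ∀ i → IsLinear (λ x → prefix (λ r → ψ r x) i)
prefix-linear ψ L zero    = L zero
prefix-linear ψ L (suc i) = +-linear (L zero) (prefix-linear (ψ ∘ suc) (L ∘ suc) i)

hIn-linear : ∀ {d k} (ψ : Fin k → ℚ^ d → ℚ) → (∀ r → IsLinear (ψ r)) →
  ∀ j → IsLinear (λ x → hIn (λ r → ψ r x) j)
hIn-linear ψ L zero    = zero-linear
hIn-linear ψ L (suc j) = L j

hOut-linear : ∀ {d k} (ψ : Fin k → ℚ^ d → ℚ) → (∀ r → IsLinear (ψ r)) →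
  ∀ j → IsLinear (λ x → hOut (λ r → ψ r x) j)
hOut-linear {k = zero}  ψ L zero    = zero-linear
hOut-linear {k = suc k} ψ L zero    = L zero
hOut-linear {k = suc k} ψ L (suc j) = hOut-linear (ψ ∘ suc) (L ∘ suc) j

-- z / 1 normalises through a gcd computation; sums of integers only compute on the normal form.
/1-normal : ∀ z → z / 1 ≡ mkℚ z 0 (coprime-sym (1-coprimeTo _))
/1-normal (ℤ.+ n)   = ℚ.normalize-coprime {n} {0} (coprime-sym (1-coprimeTo _))
/1-normal -[1+ n ] = cong -_ (ℚ.normalize-coprime {suc n} {0} (coprime-sym (1-coprimeTo _)))

IsInt-0 : IsInt 0ℚ
IsInt-0 = ℤ.+ 0 , refl

IsInt-ℕ→ℚ : ∀ k → IsInt (ℕ→ℚ k)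
IsInt-ℕ→ℚ k = ℤ.+ k , refl

IsInt-+ : ∀ {p q} → IsInt p → IsInt q → IsInt (p + q)
IsInt-+ (z , refl) (w , refl) rewrite /1-normal z | /1-normal w = z ℤ.* ℤ.+ 1 ℤ.+ w ℤ.* ℤ.+ 1 , refl

IsInt-neg : ∀ {p} → IsInt p → IsInt (- p)
IsInt-neg (z , refl) rewrite /1-normal z = ℤ.- z , sym (trans (/1-normal (ℤ.- z)) (neg-normal z))
  where
  neg-normal : ∀ z → mkℚ (ℤ.- z) 0 (coprime-sym (1-coprimeTo _)) ≡ - mkℚ z 0 (coprime-sym (1-coprimeTo _))
  neg-normal (ℤ.+ zero)  = refl
  neg-normal (ℤ.+ suc n) = refl
  neg-normal -[1+ n ]  = refl

IsInt-sub : ∀ {p q} → IsInt p → IsInt q → IsInt (p - q)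
IsInt-sub p-int q-int = IsInt-+ p-int (IsInt-neg q-int)

IsInt-prefix : ∀ {n} (f : Fin n → ℚ) → (∀ k → IsInt (f k)) → ∀ i → IsInt (prefix f i)
IsInt-prefix f f-int zero    = f-int zero
IsInt-prefix f f-int (suc i) = IsInt-+ (f-int zero) (IsInt-prefix (f ∘ suc) (f-int ∘ suc) i)

IsInt-hIn : ∀ {m} (h : Fin m → ℚ) → (∀ k → IsInt (h k)) → ∀ j → IsInt (hIn h j)
IsInt-hIn h h-int zero    = IsInt-0
IsInt-hIn h h-int (suc j) = h-int j

IsInt-hOut : ∀ {m} (h : Fin m → ℚ) → (∀ k → IsInt (h k)) → ∀ j → IsInt (hOut h j)
IsInt-hOut {zero}  h h-int zero    = IsInt-0
IsInt-hOut {suc m} h h-int zero    = h-int zero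
IsInt-hOut {suc m} h h-int (suc j) = IsInt-hOut (h ∘ suc) (h-int ∘ suc) j

IsInt-demand : ∀ {m} {α β} → IsInt α → IsInt β → ∀ (j : Fin (suc m)) → IsInt (demand α β j)
IsInt-demand α-int β-int zero = α-int
IsInt-demand {m} α-int β-int (suc j) with toℕ (suc j) ℕ.≟ m
... | yes _ = IsInt-neg β-int
... | no  _ = IsInt-0

hOut-last : ∀ {m} (h : Fin m → ℚ) (j : Fin (suc m)) → toℕ j ≡ m → hOut h j ≡ 0ℚ
hOut-last {zero}  h zero    _  = refl
hOut-last {suc m} h (suc j) eq = hOut-last (h ∘ suc) j (suc-injective eq)

hOut-inner : ∀ {m} (h : Fin m → ℚ) (j : Fin (suc m)) → ¬ toℕ j ≡ m →
  Σ (Fin m) λ c → toℕ c ≡ toℕ j × hOut h j ≡ h c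
hOut-inner {zero}  h zero    j≢m = ⊥-elim (j≢m refl)
hOut-inner {suc m} h zero    _   = zero , refl , refl
hOut-inner {suc m} h (suc j) j≢m with hOut-inner (h ∘ suc) j (j≢m ∘ cong suc)
... | c , c≡j , hOut≡ = suc c , cong suc c≡j , hOut≡

last-or-successor : ∀ {m} (j : Fin m) → suc (toℕ j) ≡ m ⊎ Σ (Fin m) λ c → toℕ c ≡ suc (toℕ j)
last-or-successor {suc zero}    zero    = inj₁ refl
last-or-successor {suc (suc m)} zero    = inj₂ (suc zero , refl)
last-or-successor {suc (suc m)} (suc j) with last-or-successor j
... | inj₁ j-last       = inj₁ (cong suc j-last)
... | inj₂ (c , c≡j+1) = inj₂ (suc c , cong suc c≡j+1)

successor-not-last : ∀ {m} (j c : Fin m) → toℕ c ≡ suc (toℕ j) → ¬ suc (toℕ j) ≡ m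
successor-not-last j c c≡j+1 j+1≡m = <-irrefl (trans c≡j+1 j+1≡m) (toℕ<n c)

hOut-cong : ∀ {m} {h h′ : Fin m → ℚ} → h ≐ h′ → ∀ j → hOut h j ≡ hOut h′ j
hOut-cong {zero}  h≐h′ zero    = refl
hOut-cong {suc m} h≐h′ zero    = h≐h′ zero
hOut-cong {suc m} h≐h′ (suc j) = hOut-cong (h≐h′ ∘ suc) j

hIn-cong : ∀ {m} {h h′ : Fin m → ℚ} → h ≐ h′ → ∀ j → hIn h j ≡ hIn h′ j
hIn-cong h≐h′ zero    = refl
hIn-cong h≐h′ (suc j) = h≐h′ j

dIn-cong : ∀ {n} {d d′ : Fin n → ℚ} → d ≐ d′ → ∀ i → dIn d i ≡ dIn d′ i
dIn-cong {suc n} d≐d′ zero    = refl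
dIn-cong {suc n} d≐d′ (suc i) = d≐d′ (inject₁ i)

hOut-+ : ∀ {m} (h h′ : Fin m → ℚ) j → hOut (λ c → h c + h′ c) j ≡ hOut h j + hOut h′ j
hOut-+ {zero}  h h′ zero    = refl
hOut-+ {suc m} h h′ zero    = refl
hOut-+ {suc m} h h′ (suc j) = hOut-+ (h ∘ suc) (h′ ∘ suc) j

hIn-+ : ∀ {m} (h h′ : Fin m → ℚ) j → hIn (λ c → h c + h′ c) j ≡ hIn h j + hIn h′ j
hIn-+ h h′ zero    = refl
hIn-+ h h′ (suc j) = refl

sumFin-hIn : ∀ {m} (h : Fin m → ℚ) → sumFin (suc m) (hIn h) ≡ sumFin m h
sumFin-hIn h = ℚ.+-identityˡ _

sumFin-hOut : ∀ {m} (h : Fin m → ℚ) → sumFin (suc m) (hOut h) ≡ sumFin m h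
sumFin-hOut {zero}  h = refl
sumFin-hOut {suc m} h = cong (h zero +_) (sumFin-hOut (h ∘ suc))

demand-last : ∀ {m} α β (j : Fin m) → suc (toℕ j) ≡ m → demand {m} α β (suc j) ≡ - β
demand-last {m} α β j eq with toℕ (suc j) ℕ.≟ m
... | yes _   = refl
... | no  j≢m = ⊥-elim (j≢m eq)

demand-inner : ∀ {m} α β (j : Fin m) → ¬ suc (toℕ j) ≡ m → demand {m} α β (suc j) ≡ 0ℚ
demand-inner {m} α β j j≢m with toℕ (suc j) ℕ.≟ m
... | yes eq = ⊥-elim (j≢m eq)
... | no  _  = refl

demand-+ : ∀ {m} α β α′ β′ (j : Fin (suc m)) → demand (α + α′) (β + β′) j ≡ demand α β j + demand α′ β′ j
demand-+ α β α′ β′ zero = refl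
demand-+ {m} α β α′ β′ (suc j) with toℕ (suc j) ℕ.≟ m
... | yes _ = ℚ.neg-distrib-+ β β′
... | no  _ = refl

sumFin-demand : ∀ m α β → sumFin (suc (suc m)) (demand {suc m} α β) ≡ α - β
sumFin-demand m α β = cong (α +_) (trans (sumFin-vanishing-but-last m _ inner≡0) (demand-last α β (fromℕ m) (cong suc (toℕ-fromℕ m))))
  where
  inner≡0 : ∀ k → ¬ toℕ k ≡ m → demand {suc m} α β (suc k) ≡ 0ℚ
  inner≡0 k k≢m = demand-inner α β k (k≢m ∘ suc-injective)
  sumFin-vanishing-but-last : ∀ t (g : Fin (suc t) → ℚ) → (∀ k → ¬ toℕ k ≡ t → g k ≡ 0ℚ) → sumFin (suc t) g ≡ g (fromℕ t)
  sumFin-vanishing-but-last zero    g g≡0 = ℚ.+-identityʳ _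
  sumFin-vanishing-but-last (suc t) g g≡0 =
    trans (cong (_+ sumFin (suc t) (g ∘ suc)) (g≡0 zero (λ ())))
          (trans (ℚ.+-identityˡ _) (sumFin-vanishing-but-last t (g ∘ suc) (λ k k≢t → g≡0 (suc k) (k≢t ∘ suc-injective))))

conservation-determines-down : ∀ {n} (hout hin net d d′ : Fin n → ℚ) →
  (∀ i → hout i + d i - (hin i + dIn d i) ≡ net i) →
  (∀ i → hout i + d′ i - (hin i + dIn d′ i) ≡ net i) →
  d ≐ d′
conservation-determines-down {suc n} hout hin net d d′ cons cons′ i = from-depth (toℕ i) i refl
  where
  solved : ∀ f → (∀ i → hout i + f i - (hin i + dIn f i) ≡ net i) → ∀ i → f i ≡ dIn f i + (net i + (hin i - hout i))
  solved f cons-f i = trans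
    (solve 4 (λ o e h p → e := p :+ ((o :+ e :- (h :+ p)) :+ (h :- o))) refl (hout i) (f i) (hin i) (dIn f i))
    (cong (λ δ → dIn f i + (δ + (hin i - hout i))) (cons-f i))
  -- Induction on toℕ i: dIn refers to the row inject₁ i, which is not a subterm of suc i.
  from-depth : ∀ k i → toℕ i ≡ k → d i ≡ d′ i
  from-depth _       zero    _  = trans (solved d cons zero) (sym (solved d′ cons′ zero))
  from-depth (suc k) (suc i) eq = begin
    d (suc i)                   ≡⟨ solved d cons (suc i) ⟩
    d (inject₁ i) + increment   ≡⟨ cong (_+ increment) (from-depth k (inject₁ i) (trans (toℕ-inject₁ i) (suc-injective eq))) ⟩
    d′ (inject₁ i) + increment  ≡⟨ solved d′ cons′ (suc i) ⟨
    d′ (suc i)                  ∎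
    where
    open ≡-Reasoning
    increment = net (suc i) + (hin (suc i) - hout (suc i))

flowCoordinate-elim : ∀ {n m} (P : Fin (FlowDim n m) → Set) →
  (∀ i c → P (combine i c ↑ˡ n ℕ.* suc m)) →
  (∀ i j → P (n ℕ.* m ↑ʳ combine i j)) →
  ∀ k → P k
flowCoordinate-elim {n} {m} P horiz-case down-case k =
  subst P (join-splitAt (n ℕ.* m) (n ℕ.* suc m) k) (by-side (splitAt (n ℕ.* m) k))
  where
  by-side : ∀ s → P (join (n ℕ.* m) (n ℕ.* suc m) s)
  by-side (inj₁ l) = subst (λ l′ → P (l′ ↑ˡ n ℕ.* suc m)) (combine-remQuot {n} m l)
    (horiz-case (proj₁ (remQuot {n} m l)) (proj₂ (remQuot {n} m l)))
  by-side (inj₂ l) = subst (λ l′ → P (n ℕ.* m ↑ʳ l′)) (combine-remQuot {n} (suc m) l)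
    (down-case (proj₁ (remQuot {n} (suc m) l)) (proj₂ (remQuot {n} (suc m) l)))

module PitmanStanleyToFlow (n′ m′ : ℕ) (a b : Fin (suc n′) → ℕ) where

  n m NM : ℕ
  n  = suc n′
  m  = suc m′
  NM = n ℕ.* m

  ent : ℚ^ NM → Fin n → Fin m → ℚ
  ent = entry {n} {m}

  A B : Fin n → ℚ
  A = prefix (ℕ→ℚ ∘ a)
  B = prefix (ℕ→ℚ ∘ b)

  X : ℚ^ NM → Fin n → Fin m → ℚ
  X x i c = prefix (λ r → ent x r c) i

  downShift : Fin n → Fin (suc m) → ℚ
  downShift i = demand (A i) (B i)

  downLinear : ℚ^ NM → Fin n → Fin (suc m) → ℚ
  downLinear x i j = hIn (X x i) j - hOut (X x i) j

  downFlow : ℚ^ NM → Fin n → Fin (suc m) → ℚ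
  downFlow x i j = downShift i j + downLinear x i j

  downIncrement : ℚ^ NM → Fin n → Fin (suc m) → ℚ
  downIncrement x i j = demand (ℕ→ℚ (a i)) (ℕ→ℚ (b i)) j + (hIn (ent x i) j - hOut (ent x i) j)

  downFlow-suc : ∀ x (i : Fin n′) j → downFlow x (suc i) j ≡ downFlow x (inject₁ i) j + downIncrement x (suc i) j
  downFlow-suc x i j = begin
    demand (A (suc i)) (B (suc i)) j + (hIn (X x (suc i)) j - hOut (X x (suc i)) j)
      ≡⟨ cong₂ _+_ (cong₂ (λ α β → demand α β j) (prefix-suc (ℕ→ℚ ∘ a) i) (prefix-suc (ℕ→ℚ ∘ b) i))
                   (cong₂ _-_ (hIn-cong X-suc j) (hOut-cong X-suc j)) ⟩
    demand (A′ + α) (B′ + β) j + (hIn (λ c → X′ c + e c) j - hOut (λ c → X′ c + e c) j)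
      ≡⟨ cong₂ _+_ (demand-+ A′ B′ α β j) (cong₂ _-_ (hIn-+ X′ e j) (hOut-+ X′ e j)) ⟩
    (demand A′ B′ j + demand α β j) + ((hIn X′ j + hIn e j) - (hOut X′ j + hOut e j))
      ≡⟨ solve 6 (λ p q r s t u → (p :+ q) :+ ((r :+ s) :- (t :+ u)) := (p :+ (r :- t)) :+ (q :+ (s :- u))) refl
           (demand A′ B′ j) (demand α β j) (hIn X′ j) (hIn e j) (hOut X′ j) (hOut e j) ⟩
    downFlow x (inject₁ i) j + downIncrement x (suc i) j ∎
    where
    open ≡-Reasoning
    A′ = A (inject₁ i)
    B′ = B (inject₁ i)
    α  = ℕ→ℚ (a (suc i))
    β  = ℕ→ℚ (b (suc i))
    X′ = X x (inject₁ i)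
    e  = ent x (suc i)
    X-suc : X x (suc i) ≐ (λ c → X′ c + e c)
    X-suc c = prefix-suc (λ r → ent x r c) i

  downFlow-conservation : ∀ x i j →
    hOut (ent x i) j + downFlow x i j - (hIn (ent x i) j + dIn (λ r → downFlow x r j) i)
      ≡ demand (ℕ→ℚ (a i)) (ℕ→ℚ (b i)) j
  downFlow-conservation x zero j =
    solve 3 (λ o δ h → o :+ (δ :+ (h :- o)) :- (h :+ con 0ℚ) := δ) refl
      (hOut (ent x zero) j) (demand (ℕ→ℚ (a zero)) (ℕ→ℚ (b zero)) j) (hIn (ent x zero) j)
  downFlow-conservation x (suc i) j = trans
    (cong (λ D → hOut (ent x (suc i)) j + D - (hIn (ent x (suc i)) j + downFlow x (inject₁ i) j)) (downFlow-suc x i j))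
    (solve 4 (λ o δ h p → o :+ (p :+ (δ :+ (h :- o))) :- (h :+ p) := δ) refl
      (hOut (ent x (suc i)) j) (demand (ℕ→ℚ (a (suc i))) (ℕ→ℚ (b (suc i))) j) (hIn (ent x (suc i)) j) (downFlow x (inject₁ i) j))

  sumFin-downFlow : ∀ x i → sumFin (suc m) (downFlow x i) ≡ A i - B i
  sumFin-downFlow x i = begin
    sumFin (suc m) (downFlow x i)
      ≡⟨ sumFin-+ (suc m) (downShift i) (downLinear x i) ⟩
    sumFin (suc m) (downShift i) + sumFin (suc m) (downLinear x i)
      ≡⟨ cong₂ _+_ (sumFin-demand m′ (A i) (B i)) (sumFin-sub (suc m) (hIn (X x i)) (hOut (X x i))) ⟩
    (A i - B i) + (sumFin (suc m) (hIn (X x i)) - sumFin (suc m) (hOut (X x i)))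
      ≡⟨ cong (λ s → (A i - B i) + (s - sumFin (suc m) (hOut (X x i))))
              (trans (sumFin-hIn (X x i)) (sym (sumFin-hOut (X x i)))) ⟩
    (A i - B i) + (sumFin (suc m) (hOut (X x i)) - sumFin (suc m) (hOut (X x i)))
      ≡⟨ cong (A i - B i +_) (ℚ.+-inverseʳ (sumFin (suc m) (hOut (X x i)))) ⟩
    (A i - B i) + 0ℚ
      ≡⟨ ℚ.+-identityʳ _ ⟩
    A i - B i ∎
    where open ≡-Reasoning

  downFlow-first : ∀ x i → downFlow x i zero ≡ A i - X x i zero
  downFlow-first x i = cong (A i +_) (ℚ.+-identityˡ (- X x i zero))

  downFlow-last : ∀ x i (j : Fin m) → suc (toℕ j) ≡ m → downFlow x i (suc j) ≡ X x i j - B i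
  downFlow-last x i j j-last = begin
    demand (A i) (B i) (suc j) + (X x i j - hOut (X x i) (suc j))
      ≡⟨ cong₂ (λ δ o → δ + (X x i j - o)) (demand-last (A i) (B i) j j-last) (hOut-last (X x i) (suc j) j-last) ⟩
    - B i + (X x i j - 0ℚ)
      ≡⟨ solve 2 (λ p q → :- q :+ (p :- con 0ℚ) := p :- q) refl (X x i j) (B i) ⟩
    X x i j - B i ∎
    where open ≡-Reasoning

  downFlow-inner : ∀ x i (j c : Fin m) → toℕ c ≡ suc (toℕ j) → downFlow x i (suc j) ≡ X x i j - X x i c
  downFlow-inner x i j c c≡j+1 with hOut-inner (X x i) (suc j) (successor-not-last j c c≡j+1)
  ... | c′ , c′≡j+1 , hOut≡ = begin
    demand (A i) (B i) (suc j) + (X x i j - hOut (X x i) (suc j))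
      ≡⟨ cong₂ (λ δ o → δ + (X x i j - o)) (demand-inner (A i) (B i) j (successor-not-last j c c≡j+1)) hOut≡ ⟩
    0ℚ + (X x i j - X x i c′)
      ≡⟨ ℚ.+-identityˡ _ ⟩
    X x i j - X x i c′
      ≡⟨ cong (λ k → X x i j - X x i k) (toℕ-injective (trans c′≡j+1 (sym c≡j+1))) ⟩
    X x i j - X x i c ∎
    where open ≡-Reasoning

  PS⇒downFlow-nonneg : ∀ x → PS n m a b x → ∀ i j → 0ℚ ≤ℚ downFlow x i j
  PS⇒downFlow-nonneg x (_ , chain) i zero =
    subst (0ℚ ≤ℚ_) (sym (downFlow-first x i)) (q≤p⇒0≤p-q (proj₂ (proj₂ (chain i)) zero refl))
  PS⇒downFlow-nonneg x (_ , chain) i (suc j) with last-or-successor j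
  ... | inj₁ j-last = subst (0ℚ ≤ℚ_) (sym (downFlow-last x i j j-last)) (q≤p⇒0≤p-q (proj₁ (chain i) j j-last))
  ... | inj₂ (c , c≡j+1) = subst (0ℚ ≤ℚ_) (sym (downFlow-inner x i j c c≡j+1))
                             (q≤p⇒0≤p-q (proj₁ (proj₂ (chain i)) j c c≡j+1))

  downFlow-nonneg⇒PS : ∀ x → (∀ i c → 0ℚ ≤ℚ ent x i c) → (∀ i j → 0ℚ ≤ℚ downFlow x i j) → PS n m a b x
  downFlow-nonneg⇒PS x x-nonneg D-nonneg = x-nonneg , λ i →
      (λ j j-last → 0≤p-q⇒q≤p (subst (0ℚ ≤ℚ_) (downFlow-last x i j j-last) (D-nonneg i (suc j))))
    , (λ j c c≡j+1 → 0≤p-q⇒q≤p (subst (0ℚ ≤ℚ_) (downFlow-inner x i j c c≡j+1) (D-nonneg i (suc j))))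
    , λ { zero _ → 0≤p-q⇒q≤p (subst (0ℚ ≤ℚ_) (downFlow-first x i) (D-nonneg i zero)) }

  shiftAt : Fin NM ⊎ Fin (n ℕ.* suc m) → ℚ
  shiftAt (inj₁ _) = 0ℚ
  shiftAt (inj₂ l) = downShift (proj₁ (remQuot {n} (suc m) l)) (proj₂ (remQuot {n} (suc m) l))

  formAt : Fin NM ⊎ Fin (n ℕ.* suc m) → ℚ^ NM → ℚ
  formAt (inj₁ l) x = x l
  formAt (inj₂ l) x = downLinear x (proj₁ (remQuot {n} (suc m) l)) (proj₂ (remQuot {n} (suc m) l))

  downLinear-linear : ∀ i j → IsLinear (λ x → downLinear x i j)
  downLinear-linear i j = sub-linear (hIn-linear (λ c x → X x i c) X-linear j) (hOut-linear (λ c x → X x i c) X-linear j)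
    where
    X-linear : ∀ c → IsLinear (λ x → X x i c)
    X-linear c = prefix-linear (λ r x → ent x r c) (λ r → eval-linear (combine r c)) i

  formAt-linear : ∀ s → IsLinear (formAt s)
  formAt-linear (inj₁ l) = eval-linear l
  formAt-linear (inj₂ l) = downLinear-linear (proj₁ (remQuot {n} (suc m) l)) (proj₂ (remQuot {n} (suc m) l))

  Φ : Affine NM (FlowDim n m)
  Φ = affineFromForms (shiftAt ∘ splitAt NM) (formAt ∘ splitAt NM)

  Φ-coordinate : ∀ x k → applyAff Φ x k ≡ shiftAt (splitAt NM k) + formAt (splitAt NM k) x
  Φ-coordinate = applyAff-affineFromForms (shiftAt ∘ splitAt NM) (formAt ∘ splitAt NM) (formAt-linear ∘ splitAt NM)

  Φ-↑ˡ : ∀ x l → applyAff Φ x (l ↑ˡ n ℕ.* suc m) ≡ x l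
  Φ-↑ˡ x l rewrite Φ-coordinate x (l ↑ˡ n ℕ.* suc m) | splitAt-↑ˡ NM l (n ℕ.* suc m) = ℚ.+-identityˡ (x l)

  Φ-down : ∀ x i j → down (applyAff Φ x) i j ≡ downFlow x i j
  Φ-down x i j rewrite Φ-coordinate x (NM ↑ʳ combine i j) | splitAt-↑ʳ NM (n ℕ.* suc m) (combine i j)
    = cong (λ (i , j) → downFlow x i j) (remQuot-combine {n} {suc m} i j)

  Φ-into-Flow : ∀ x → PS n m a b x → Flow n m a b (applyAff Φ x)
  Φ-into-Flow x x∈PS = flowCoordinate-elim (λ k → 0ℚ ≤ℚ applyAff Φ x k) horiz-nonneg down-nonneg
                     , conservation , sink
    where
    F = applyAff Φ x
    horiz-nonneg : ∀ i c → 0ℚ ≤ℚ horiz F i c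
    horiz-nonneg i c = subst (0ℚ ≤ℚ_) (sym (Φ-↑ˡ x (combine i c))) (proj₁ x∈PS i c)
    down-nonneg : ∀ i j → 0ℚ ≤ℚ down F i j
    down-nonneg i j = subst (0ℚ ≤ℚ_) (sym (Φ-down x i j)) (PS⇒downFlow-nonneg x x∈PS i j)
    conservation : ∀ i j → (hOut (horiz F i) j + down F i j) - (hIn (horiz F i) j + dIn (λ r → down F r j) i)
                             ≡ demand (ℕ→ℚ (a i)) (ℕ→ℚ (b i)) j
    conservation i j = trans
      (cong₂ _-_ (cong₂ _+_ (hOut-cong (Φ-↑ˡ x ∘ combine i) j) (Φ-down x i j))
                 (cong₂ _+_ (hIn-cong (Φ-↑ˡ x ∘ combine i) j) (dIn-cong (λ r → Φ-down x r j) i)))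
      (downFlow-conservation x i j)
    sink : ∀ l → suc (toℕ l) ≡ n →
      0ℚ - sumFin (suc m) (down F l) ≡ (- sumFin n (ℕ→ℚ ∘ a)) + sumFin n (ℕ→ℚ ∘ b)
    sink l l-last = begin
      0ℚ - sumFin (suc m) (down F l)      ≡⟨ cong (λ s → 0ℚ - s) (sumFin-cong (suc m) (Φ-down x l)) ⟩
      0ℚ - sumFin (suc m) (downFlow x l)  ≡⟨ cong (λ s → 0ℚ - s) (sumFin-downFlow x l) ⟩
      0ℚ - (A l - B l)                    ≡⟨ cong₂ (λ α β → 0ℚ - (α - β)) (prefix-last (ℕ→ℚ ∘ a) l l-last) (prefix-last (ℕ→ℚ ∘ b) l l-last) ⟩
      0ℚ - (Σa - Σb)                      ≡⟨ solve 2 (λ p q → con 0ℚ :- (p :- q) := (:- p) :+ q) refl Σa Σb ⟩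
      (- Σa) + Σb ∎
      where
      open ≡-Reasoning
      Σa = sumFin n (ℕ→ℚ ∘ a)
      Σb = sumFin n (ℕ→ℚ ∘ b)

  restrict : ℚ^ (FlowDim n m) → ℚ^ NM
  restrict y l = y (l ↑ˡ n ℕ.* suc m)

  down-determined : ∀ y → Flow n m a b y → ∀ i j → down y i j ≡ downFlow (restrict y) i j
  down-determined y (_ , cons , _) i j = conservation-determines-down
    (λ r → hOut (horiz y r) j) (λ r → hIn (horiz y r) j) (λ r → demand (ℕ→ℚ (a r)) (ℕ→ℚ (b r)) j) (λ r → down y r j) (λ r → downFlow (restrict y) r j)
    (λ r → cons r j) (λ r → downFlow-conservation (restrict y) r j) i

  restrict-into-PS : ∀ y → Flow n m a b y → PS n m a b (restrict y)
  restrict-into-PS y y∈Flow@(y-nonneg , _) = downFlow-nonneg⇒PS (restrict y) (λ i c → y-nonneg (combine i c ↑ˡ n ℕ.* suc m))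
    (λ i j → subst (0ℚ ≤ℚ_) (down-determined y y∈Flow i j) (y-nonneg (NM ↑ʳ combine i j)))

  Φ-restrict : ∀ y → Flow n m a b y → applyAff Φ (restrict y) ≐ y
  Φ-restrict y y∈Flow = flowCoordinate-elim (λ k → applyAff Φ (restrict y) k ≡ y k)
    (λ i c → Φ-↑ˡ (restrict y) (combine i c))
    (λ i j → trans (Φ-down (restrict y) i j) (sym (down-determined y y∈Flow i j)))

  Φ-integral : ∀ x → IsIntPt x → IsIntPt (applyAff Φ x)
  Φ-integral x x-int = flowCoordinate-elim (λ k → IsInt (applyAff Φ x k))
    (λ i c → subst IsInt (sym (Φ-↑ˡ x (combine i c))) (x-int (combine i c)))
    (λ i j → subst IsInt (sym (Φ-down x i j))
      (IsInt-+ (IsInt-demand (IsInt-prefix _ (IsInt-ℕ→ℚ ∘ a) i) (IsInt-prefix _ (IsInt-ℕ→ℚ ∘ b) i) j)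
               (IsInt-sub (IsInt-hIn (X x i) (X-int i) j) (IsInt-hOut (X x i) (X-int i) j))))
    where
    X-int : ∀ i c → IsInt (X x i c)
    X-int i c = IsInt-prefix (λ r → ent x r c) (λ r → x-int (combine r c)) i

  integrallyEquivalent : IntegrallyEquivalent (PS n m a b) (Flow n m a b)
  integrallyEquivalent = integrallyEquivalent-byProjection Φ (_↑ˡ n ℕ.* suc m)
    Φ-↑ˡ Φ-into-Flow restrict-into-PS Φ-restrict Φ-integral

theorem3p4 : (n m : ℕ) → 1 ≤ n → 1 ≤ m → (a b : Fin n → ℕ) →
    IntegrallyEquivalent (PS n m a b) (Flow n m a b)
theorem3p4 zero    m       () _  a b
theorem3p4 (suc n) zero    _  () a b
theorem3p4 (suc n) (suc m) _  _  a b = PitmanStanleyToFlow.integrallyEquivalent n m a b
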